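{- The uniform distribution on $B^\varepsilon_k(G)$ is a stationary distribution of the BUD walk on $B^\varepsilon_k(G)$. If the BUD walk is irreducible, this stationary distribution is unique.
   Context: $G$ is a connected graph with vertex populations $p:V(G)\to\mathbb{R}^+$ and total population $p(G)=\sum_v p(v)$; $\varepsilon\ge0$ and $k\ge2$ is an integer. $B^\varepsilon_k(G)$ is the set of spanning trees $T$ of $G$ for which there exist $k-1$ edges of $T$ whose removal partitions $G$ into $k$ connected components each with population in $[p(G)/k-\varepsilon/2,\,p(G)/k+\varepsilon/2]$. The BUD (Balanced Up-Down) walk on $B^\varepsilon_k(G)$ is the Markov chain whose step from $T\in B^\varepsilon_k(G)$ is: (1) add to $T$ a uniformly random edge from $E(G)\setminus E(T)$, creating a unique cycle $C$; (2) remove an edge of $C$ chosen uniformly at random from the set of edges of $C$ whose removal yields a tree in $B^\varepsilon_k(G)$.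
   Formalization: The vertex populations p and the parameter ε are rational rather than real, and uniqueness of the stationary distribution is asserted only among distributions taking rational values. -}

module Defs where

open import Data.Nat as ℕ using (ℕ; zero; suc)
open import Data.Fin as Fin using (Fin)
open import Data.Fin.Subset using (Subset; ∣_∣)
open import Data.Bool as Bool using (Bool; true; false; _∧_; _∨_; not; if_then_else_)
open import Data.Vec as Vec using (Vec; []; _∷_; lookup; _[_]≔_; zipWith)
open import Data.Vec.Properties using (≡-dec)
open import Data.List as List using (List; []; _∷_; _++_; map; filterᵇ; foldr; length; allFin)
open import Data.Integer using (+_)
open import Data.Bool.ListAction using (any; all)
open import Data.Rational as ℚ using (ℚ; 0ℚ; 1ℚ; ½; _+_; _*_; _-_; _≤_; _<_; _≤ᵇ_)
open import Data.Product using (_×_; _,_; proj₁; proj₂; Σ)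
open import Relation.Nullary.Decidable using (⌊_⌋)
open import Relation.Binary.PropositionalEquality using (_≡_; _≢_)

record Graph : Set where
  field
    n    : ℕ
    m    : ℕ
    src  : Fin m → Fin n
    tgt  : Fin m → Fin n
open Graph public

IsSimple : Graph → Set
IsSimple G =
  ((i : Fin (m G)) → src G i ≢ tgt G i) ×
  ((i j : Fin (m G)) → i ≢ j →
     ¬Same (src G i , tgt G i) (src G j , tgt G j))
  where
  ¬Same : Fin (n G) × Fin (n G) → Fin (n G) × Fin (n G) → Set
  ¬Same (a , b) (c , d) = ((a ≡ c) × (b ≡ d) → Data.Empty.⊥) × ((a ≡ d) × (b ≡ c) → Data.Empty.⊥)
    where import Data.Empty

anyFin : {k : ℕ} → (Fin k → Bool) → Bool
anyFin {k} f = any f (allFin k)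

allFin? : {k : ℕ} → (Fin k → Bool) → Bool
allFin? {k} f = all f (allFin k)

_==ᶠ_ : {k : ℕ} → Fin k → Fin k → Bool
a ==ᶠ b = ⌊ a Fin.≟ b ⌋

_==ˢ_ : {k : ℕ} → Subset k → Subset k → Bool
S ==ˢ T = ⌊ ≡-dec Bool._≟_ S T ⌋

_∖_ : {k : ℕ} → Subset k → Subset k → Subset k
S ∖ R = zipWith (λ a b → a ∧ not b) S R

addE : {k : ℕ} → Subset k → Fin k → Subset k
addE S e = S [ e ]≔ true

delE : {k : ℕ} → Subset k → Fin k → Subset k
delE S e = S [ e ]≔ false

_⊆ᵇ_ : {k : ℕ} → Subset k → Subset k → Bool
_⊆ᵇ_ {k} R S = allFin? (λ i → not (lookup R i) ∨ lookup S i)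

allSubsets : (k : ℕ) → List (Subset k)
allSubsets zero    = [] ∷ []
allSubsets (suc k) = map (true ∷_) (allSubsets k) ++ map (false ∷_) (allSubsets k)

expand : (G : Graph) → Subset (m G) → (Fin (n G) → Bool) → (Fin (n G) → Bool)
expand G S X u =
  X u ∨ anyFin (λ i → lookup S i ∧
          ((X (src G i) ∧ (tgt G i ==ᶠ u)) ∨ (X (tgt G i) ∧ (src G i ==ᶠ u))))

iter : {A : Set} → ℕ → (A → A) → A → A
iter zero    f a = a
iter (suc j) f a = f (iter j f a)

-- reach G S v u = true iff u is joined to v by a path using edges of S
-- (paths of length < n suffice, so n expansion steps compute the component).
reach : (G : Graph) → Subset (m G) → Fin (n G) → Fin (n G) → Bool
reach G S v = iter (n G) (expand G S) (λ u → v ==ᶠ u)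

connectedᵇ : (G : Graph) → Subset (m G) → Bool
connectedᵇ G S = allFin? (λ u → allFin? (λ v → reach G S u v))

Connected : Graph → Set
Connected G = connectedᵇ G (Vec.replicate (m G) true) ≡ true

-- S is acyclic: no edge of S lies on a cycle of S, i.e. the endpoints of
-- every edge f ∈ S are disconnected in S ∖ {f}.
acyclicᵇ : (G : Graph) → Subset (m G) → Bool
acyclicᵇ G S = allFin? (λ f → not (lookup S f) ∨ not (reach G (delE S f) (src G f) (tgt G f)))

spanningTreeᵇ : (G : Graph) → Subset (m G) → Bool
spanningTreeᵇ G S = connectedᵇ G S ∧ acyclicᵇ G S

sumℚ : List ℚ → ℚ
sumℚ = foldr _+_ 0ℚ

-- 1/c as a rational (with the junk value 0 for c = 0)
invℕ : ℕ → ℚ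
invℕ zero    = 0ℚ
invℕ (suc c) = + 1 ℚ./ suc c

popOf : (G : Graph) → (Fin (n G) → ℚ) → (Fin (n G) → Bool) → ℚ
popOf G p X = sumℚ (map (λ v → if X v then p v else 0ℚ) (allFin (n G)))

totalPop : (G : Graph) → (Fin (n G) → ℚ) → ℚ
totalPop G p = popOf G p (λ _ → true)

balancedᵇ : (G : Graph) → (Fin (n G) → ℚ) → ℕ → ℚ → Subset (m G) → Bool
balancedᵇ G p k ε T =
  any (λ R → (R ⊆ᵇ T) ∧ (∣ R ∣ ℕ.≡ᵇ (k ℕ.∸ 1)) ∧
                 allFin? (λ v → let c = popOf G p (reach G (T ∖ R) v) in
                                  (lo ≤ᵇ c) ∧ (c ≤ᵇ hi)))
           (allSubsets (m G))
  where
  lo = totalPop G p * invℕ k - ε * ½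
  hi = totalPop G p * invℕ k + ε * ½

inBᵇ : (G : Graph) → (Fin (n G) → ℚ) → ℕ → ℚ → Subset (m G) → Bool
inBᵇ G p k ε T = spanningTreeᵇ G T ∧ balancedᵇ G p k ε T

Bset : (G : Graph) → (Fin (n G) → ℚ) → ℕ → ℚ → List (Subset (m G))
Bset G p k ε = filterᵇ (inBᵇ G p k ε) (allSubsets (m G))

-- f is an edge of the unique cycle of H = T + e: f ∈ H and the endpoints of
-- f remain connected in H ∖ {f}.
onCycleᵇ : (G : Graph) → Subset (m G) → Fin (m G) → Bool
onCycleᵇ G H f = lookup H f ∧ reach G (delE H f) (src G f) (tgt G f)

-- transition probability of the BUD walk from T to T'
-- (convention: if E(G) ∖ E(T) is empty, the walk stays put)
budP : (G : Graph) → (Fin (n G) → ℚ) → ℕ → ℚ →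
       Subset (m G) → Subset (m G) → ℚ
budP G p k ε T T' with filterᵇ (λ e → not (lookup T e)) (allFin (m G))
... | []  = if T ==ˢ T' then 1ℚ else 0ℚ
... | es  = invℕ (length es) * sumℚ (map contrib es)
  where
  contrib : Fin (m G) → ℚ
  contrib e =
    let H = addE T e
        A = filterᵇ (λ f → onCycleᵇ G H f ∧ inBᵇ G p k ε (delE H f)) (allFin (m G))
    in invℕ (length A) *
       sumℚ (map (λ f → if delE H f ==ˢ T' then 1ℚ else 0ℚ) A)

-- distributions on B (functions on all edge subsets; only values on B matter)
IsDistribution : (G : Graph) → (Fin (n G) → ℚ) → ℕ → ℚ → (Subset (m G) → ℚ) → Set
IsDistribution G p k ε π =
  ((T : Subset (m G)) → inBᵇ G p k ε T ≡ true → 0ℚ ≤ π T) ×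
  (sumℚ (map π (Bset G p k ε)) ≡ 1ℚ)

IsStationary : (G : Graph) → (Fin (n G) → ℚ) → ℕ → ℚ → (Subset (m G) → ℚ) → Set
IsStationary G p k ε π =
  (T' : Subset (m G)) → inBᵇ G p k ε T' ≡ true →
  sumℚ (map (λ T → π T * budP G p k ε T T') (Bset G p k ε)) ≡ π T'

uniformB : (G : Graph) → (Fin (n G) → ℚ) → ℕ → ℚ → Subset (m G) → ℚ
uniformB G p k ε T = invℕ (length (Bset G p k ε))

data Reaches (G : Graph) (p : Fin (n G) → ℚ) (k : ℕ) (ε : ℚ) :
             Subset (m G) → Subset (m G) → Set where
  here : ∀ {T} → Reaches G p k ε T T
  step : ∀ {T T₁ T'} → inBᵇ G p k ε T₁ ≡ true → 0ℚ < budP G p k ε T T₁ →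
         Reaches G p k ε T₁ T' → Reaches G p k ε T T'

Irreducible : (G : Graph) → (Fin (n G) → ℚ) → ℕ → ℚ → Set
Irreducible G p k ε =
  (T T' : Subset (m G)) → inBᵇ G p k ε T ≡ true → inBᵇ G p k ε T' ≡ true →
  Reaches G p k ε T T'

{-# OPTIONS --safe #-}

-- The BUD walk is a symmetric Markov chain on B = B^ε_k(G). Write A(H) for the edges f on the
-- cycle of H whose removal leaves a tree of B. For T ≠ T′, P(T, T′) is the sum, over the pairs
-- (e, f) with T′ = T + e − f, of 1 / (|E ∖ T| · |A(T + e)|). The pair (f, e) describes the
-- reverse move with the same weight: T′ + f = T + e, the edge e lies on that cycle because T is
-- connected, and |E ∖ T′| = |E ∖ T|. So P is symmetric, its columns sum to 1 like its rows, and
-- the uniform distribution is stationary.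
--
-- For uniqueness let π be stationary with maximum M. Wherever π(T′) = M,
-- M = π(T′) = Σ_T π(T) P(T, T′) ≤ M · Σ_T P(T, T′) = M, so π(T) = M whenever P(T, T′) > 0.
-- Irreducibility spreads this over all of B, so π is constant, hence uniform.

module Submission where

open import Defs
open import Algebra.Bundles using (CommutativeMonoid)
import Algebra.Properties.CommutativeSemigroup as CommutativeSemigroupProperties
open import Data.Bool as Bool using (Bool; true; false; _∧_; not; if_then_else_; T?)
open import Data.Bool.Properties using (T-≡; T-not-≡; not-injective; if-eta)
open import Data.Fin using (Fin; zero; suc)
open import Data.Fin.Subset using (Subset)
import Data.Integer as ℤ
import Data.Integer.Properties as ℤ
open import Data.List using (List; []; _∷_; _++_; map; filterᵇ; length; allFin; tabulate)
import Data.List.Extrema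
open import Data.List.Membership.Propositional using (_∈_)
open import Data.List.Membership.Propositional.Properties
  using (∈-filter⁺; ∈-filter⁻; ∈-allFin; ∈-++⁺ˡ; ∈-++⁺ʳ; ∈-map⁺)
open import Data.List.Relation.Unary.All as All using ()
open import Data.List.Relation.Unary.All.Properties using (all⁺)
open import Data.List.Relation.Unary.Any using (here; there)
open import Data.Nat as ℕ using (ℕ; zero; suc)
open import Data.Nat.Coprimality using (1-coprimeTo) renaming (sym to coprime-sym)
open import Data.Product using (_×_; _,_; proj₁; proj₂)
open import Data.Rational using (ℚ; 0ℚ; 1ℚ; _+_; _*_; _≤_; _<_; mkℚ)
import Data.Rational as ℚ
open import Data.Rational.Properties
open import Data.Vec using (Vec; []; _∷_; lookup; _[_]≔_)
open import Data.Vec.Properties using (≡-dec; []≔-idempotent; []≔-lookup; lookup∘update)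
open import Function using (_∘_; id; Equivalence)
open import Relation.Nullary.Decidable using (yes; no; isYes≗does; dec-true; dec-false; toWitness)
open import Relation.Binary.Bundles using (DecTotalOrder)
open import Relation.Binary.PropositionalEquality

private variable
  A A′ : Set

open CommutativeSemigroupProperties (CommutativeMonoid.commutativeSemigroup +-0-commutativeMonoid)
  using () renaming (interchange to +-interchange)
open CommutativeSemigroupProperties (CommutativeMonoid.commutativeSemigroup *-1-commutativeMonoid)
  using () renaming (x∙yz≈y∙xz to *-leftComm)

-- Sums and means over lists

∑ : List A → (A → ℚ) → ℚ
∑ xs f = sumℚ (map f xs)

∑-cong : ∀ (xs : List A) {f g : A → ℚ} → (∀ x → x ∈ xs → f x ≡ g x) → ∑ xs f ≡ ∑ xs g
∑-cong []       _   = refl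
∑-cong (x ∷ xs) f≗g = cong₂ _+_ (f≗g x (here refl)) (∑-cong xs (λ y → f≗g y ∘ there))

∑-distrib-+ : ∀ (xs : List A) f g → ∑ xs (λ x → f x + g x) ≡ ∑ xs f + ∑ xs g
∑-distrib-+ []       f g = refl
∑-distrib-+ (x ∷ xs) f g =
  trans (cong ((f x + g x) +_) (∑-distrib-+ xs f g)) (+-interchange (f x) (g x) (∑ xs f) (∑ xs g))

∑-distribˡ-* : ∀ (xs : List A) c f → ∑ xs (λ x → c * f x) ≡ c * ∑ xs f
∑-distribˡ-* []       c f = sym (*-zeroʳ c)
∑-distribˡ-* (x ∷ xs) c f =
  trans (cong (c * f x +_) (∑-distribˡ-* xs c f)) (sym (*-distribˡ-+ c (f x) (∑ xs f)))

∑-++ : ∀ (xs ys : List A) f → ∑ (xs ++ ys) f ≡ ∑ xs f + ∑ ys f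
∑-++ []       ys f = sym (+-identityˡ (∑ ys f))
∑-++ (x ∷ xs) ys f = trans (cong (f x +_) (∑-++ xs ys f)) (sym (+-assoc (f x) (∑ xs f) (∑ ys f)))

∑-map : ∀ (xs : List A) (h : A → A′) f → ∑ (map h xs) f ≡ ∑ xs (f ∘ h)
∑-map []       h f = refl
∑-map (x ∷ xs) h f = cong (f (h x) +_) (∑-map xs h f)

∑-filterᵇ : ∀ (φ : A → Bool) xs f → ∑ (filterᵇ φ xs) f ≡ ∑ xs (λ x → if φ x then f x else 0ℚ)
∑-filterᵇ φ []       f = refl
∑-filterᵇ φ (x ∷ xs) f with φ x
... | true  = cong (f x +_) (∑-filterᵇ φ xs f)
... | false = trans (∑-filterᵇ φ xs f) (sym (+-identityˡ _))

fromℕ : ℕ → ℚ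
fromℕ zero    = 0ℚ
fromℕ (suc n) = 1ℚ + fromℕ n

∑-const : ∀ (xs : List A) c → ∑ xs (λ _ → c) ≡ c * fromℕ (length xs)
∑-const []       c = sym (*-zeroʳ c)
∑-const (x ∷ xs) c = begin
  c + ∑ xs (λ _ → c)           ≡⟨ cong₂ _+_ (sym (*-identityʳ c)) (∑-const xs c) ⟩
  c * 1ℚ + c * fromℕ (length xs) ≡⟨ *-distribˡ-+ c 1ℚ _ ⟨
  c * fromℕ (suc (length xs))  ∎
  where open ≡-Reasoning

∑-zero : ∀ (xs : List A) → ∑ xs (λ _ → 0ℚ) ≡ 0ℚ
∑-zero xs = trans (∑-const xs 0ℚ) (*-zeroˡ (fromℕ (length xs)))

∑-comm : ∀ (xs : List A) (ys : List A′) (g : A → A′ → ℚ) →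
         ∑ xs (λ x → ∑ ys (g x)) ≡ ∑ ys (λ y → ∑ xs (λ x → g x y))
∑-comm []       ys g = sym (∑-zero ys)
∑-comm (x ∷ xs) ys g =
  trans (cong (∑ ys (g x) +_) (∑-comm xs ys g))
        (sym (∑-distrib-+ ys (g x) (λ y → ∑ xs (λ x′ → g x′ y))))

∑-mono-≤ : ∀ (xs : List A) {f g} → (∀ x → x ∈ xs → f x ≤ g x) → ∑ xs f ≤ ∑ xs g
∑-mono-≤ []       _   = ≤-refl
∑-mono-≤ (x ∷ xs) f≤g = +-mono-≤ (f≤g x (here refl)) (∑-mono-≤ xs (λ y → f≤g y ∘ there))

∑-nonNeg : ∀ (xs : List A) {f} → (∀ x → x ∈ xs → 0ℚ ≤ f x) → 0ℚ ≤ ∑ xs f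
∑-nonNeg xs {f} 0≤f = subst (_≤ ∑ xs f) (∑-zero xs) (∑-mono-≤ xs 0≤f)

∑-mono-≤-≡⇒≡ : ∀ (xs : List A) {f g} → (∀ x → x ∈ xs → f x ≤ g x) →
               ∑ xs f ≡ ∑ xs g → ∀ x → x ∈ xs → f x ≡ g x
∑-mono-≤-≡⇒≡ (y ∷ xs) {f} {g} f≤g ∑f≡∑g = go
  where
  head≤ : f y ≤ g y
  head≤ = f≤g y (here refl)
  tail≤ : ∑ xs f ≤ ∑ xs g
  tail≤ = ∑-mono-≤ xs (λ z → f≤g z ∘ there)
  head≡ : f y ≡ g y
  head≡ = ≤-antisym head≤ (≮⇒≥ λ fy<gy → <⇒≢ (+-mono-<-≤ fy<gy tail≤) ∑f≡∑g)
  tail≡ : ∑ xs f ≡ ∑ xs g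
  tail≡ = ≤-antisym tail≤ (≮⇒≥ λ ∑<∑ → <⇒≢ (+-mono-≤-< head≤ ∑<∑) ∑f≡∑g)
  go : ∀ x → x ∈ y ∷ xs → f x ≡ g x
  go _ (here refl) = head≡
  go x (there x∈xs) = ∑-mono-≤-≡⇒≡ xs (λ z → f≤g z ∘ there) tail≡ x x∈xs

fromℕ≡mkℚ : ∀ n → fromℕ n ≡ mkℚ (ℤ.+ n) 0 (coprime-sym (1-coprimeTo n))
fromℕ≡mkℚ zero    = refl
fromℕ≡mkℚ (suc n) rewrite fromℕ≡mkℚ n =
  trans (/-cong {p₂ = ℤ.+ suc n} (cong (ℤ._+_ (ℤ.+ 1)) (ℤ.*-identityʳ (ℤ.+ n))) refl)
        (normalize-coprime (coprime-sym (1-coprimeTo (suc n))))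

invℕ-inverse : ∀ n → invℕ (suc n) * fromℕ (suc n) ≡ 1ℚ
invℕ-inverse n rewrite normalize-coprime (1-coprimeTo (suc n)) | fromℕ≡mkℚ (suc n) =
  *-inverseˡ (mkℚ (ℤ.+ suc n) 0 (coprime-sym (1-coprimeTo (suc n))))

invℕ-nonNeg : ∀ n → 0ℚ ≤ invℕ n
invℕ-nonNeg zero    = ≤-refl
invℕ-nonNeg (suc n) = nonNegative⁻¹ (invℕ (suc n)) {{normalize-nonNeg 1 (suc n)}}

*-cancelʳ-≡-pos : ∀ {p q} r → 0ℚ < r → p * r ≡ q * r → p ≡ q
*-cancelʳ-≡-pos r 0<r pr≡qr = ≤-antisym
  (*-cancelʳ-≤-pos r (≤-reflexive pr≡qr)) (*-cancelʳ-≤-pos r (≤-reflexive (sym pr≡qr)))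
  where instance _ = ℚ.positive 0<r

*-if : ∀ c b {x} → c * (if b then x else 0ℚ) ≡ (if b then c * x else 0ℚ)
*-if c true  = refl
*-if c false = *-zeroʳ c

mean : List A → (A → ℚ) → ℚ
mean xs f = invℕ (length xs) * ∑ xs f

∑-invℕ-length : ∀ (xs : List A) → 1 ℕ.≤ length xs → ∑ xs (λ _ → invℕ (length xs)) ≡ 1ℚ
∑-invℕ-length (x ∷ xs) _ =
  trans (∑-const (x ∷ xs) (invℕ (suc (length xs)))) (invℕ-inverse (length xs))

mean-const : ∀ {x} {xs : List A} → x ∈ xs → ∀ c → mean xs (λ _ → c) ≡ c
mean-const {xs = xs@(_ ∷ xs′)} _ c = begin
  invℕ (length xs) * ∑ xs (λ _ → c)          ≡⟨ cong (invℕ (length xs) *_) (∑-const xs c) ⟩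
  invℕ (length xs) * (c * fromℕ (length xs)) ≡⟨ *-leftComm (invℕ (length xs)) c (fromℕ (length xs)) ⟩
  c * (invℕ (length xs) * fromℕ (length xs)) ≡⟨ cong (c *_) (invℕ-inverse (length xs′)) ⟩
  c * 1ℚ                                     ≡⟨ *-identityʳ c ⟩
  c                                          ∎
  where open ≡-Reasoning

∑-const≡1⇒≡invℕ : ∀ (xs : List A) {c} → ∑ xs (λ _ → c) ≡ 1ℚ → c ≡ invℕ (length xs)
∑-const≡1⇒≡invℕ []           ()
∑-const≡1⇒≡invℕ xs@(_ ∷ _) {c} ∑c≡1 = begin
  c                                  ≡⟨ mean-const {xs = xs} (here refl) c ⟨
  invℕ (length xs) * ∑ xs (λ _ → c) ≡⟨ cong (invℕ (length xs) *_) ∑c≡1 ⟩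
  invℕ (length xs) * 1ℚ              ≡⟨ *-identityʳ _ ⟩
  invℕ (length xs)                   ∎
  where open ≡-Reasoning

mean-nonNeg : ∀ (xs : List A) {f} → (∀ x → x ∈ xs → 0ℚ ≤ f x) → 0ℚ ≤ mean xs f
mean-nonNeg xs {f} 0≤f = nonNegative⁻¹ (mean xs f)
  {{nonNeg*nonNeg⇒nonNeg (invℕ (length xs)) {{ℚ.nonNegative (invℕ-nonNeg (length xs))}}
                         (∑ xs f) {{ℚ.nonNegative (∑-nonNeg xs 0≤f)}}}}

mean-filterᵇ : ∀ (φ : A → Bool) xs f →
  mean (filterᵇ φ xs) f ≡ ∑ xs (λ x → if φ x then invℕ (length (filterᵇ φ xs)) * f x else 0ℚ)
mean-filterᵇ φ xs f = begin
  c * ∑ (filterᵇ φ xs) f                          ≡⟨ cong (c *_) (∑-filterᵇ φ xs f) ⟩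
  c * ∑ xs (λ x → if φ x then f x else 0ℚ)       ≡⟨ ∑-distribˡ-* xs c (λ x → if φ x then f x else 0ℚ) ⟨
  ∑ xs (λ x → c * (if φ x then f x else 0ℚ))     ≡⟨ ∑-cong xs (λ x _ → *-if c (φ x)) ⟩
  ∑ xs (λ x → if φ x then c * f x else 0ℚ)       ∎
  where
  open ≡-Reasoning
  c = invℕ (length (filterᵇ φ xs))

∑-mean : ∀ {x₀} (xs : List A) (ys : List A′) (g : A → A′ → ℚ) → x₀ ∈ xs →
         (∀ x → x ∈ xs → ∑ ys (g x) ≡ 1ℚ) → ∑ ys (λ y → mean xs (λ x → g x y)) ≡ 1ℚ
∑-mean xs ys g x₀∈xs ∑g≡1 = begin
  ∑ ys (λ y → c * ∑ xs (λ x → g x y)) ≡⟨ ∑-distribˡ-* ys c (λ y → ∑ xs (λ x → g x y)) ⟩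
  c * ∑ ys (λ y → ∑ xs (λ x → g x y)) ≡⟨ cong (c *_) (∑-comm xs ys g) ⟨
  c * ∑ xs (λ x → ∑ ys (g x))         ≡⟨ cong (c *_) (∑-cong xs ∑g≡1) ⟩
  mean xs (λ _ → 1ℚ)                  ≡⟨ mean-const x₀∈xs 1ℚ ⟩
  1ℚ                                  ∎
  where
  open ≡-Reasoning
  c = invℕ (length xs)

-- A maximum principle for stationary distributions

stationary-max⇒pred-max :
  ∀ (B : List A) (P : A → A → ℚ) (π : A → ℚ) {M x y} →
  (∀ x y → 0ℚ ≤ P x y) →
  (∀ {y} → y ∈ B → ∑ B (λ x → P x y) ≡ 1ℚ) →
  (∀ {y} → y ∈ B → ∑ B (λ x → π x * P x y) ≡ π y) →
  (∀ {x} → x ∈ B → π x ≤ M) →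
  y ∈ B → π y ≡ M → x ∈ B → 0ℚ < P x y → π x ≡ M
stationary-max⇒pred-max B P π {M} {x} {y} P≥0 colSum stationary π≤M y∈B πy≡M x∈B 0<Pxy =
  *-cancelʳ-≡-pos (P x y) 0<Pxy (∑-mono-≤-≡⇒≡ B terms≤ sums≡ x x∈B)
  where
  terms≤ : ∀ z → z ∈ B → π z * P z y ≤ M * P z y
  terms≤ z z∈B = *-monoʳ-≤-nonNeg (P z y) {{ℚ.nonNegative (P≥0 z y)}} (π≤M z∈B)
  sums≡ : ∑ B (λ z → π z * P z y) ≡ ∑ B (λ z → M * P z y)
  sums≡ = begin
    ∑ B (λ z → π z * P z y) ≡⟨ stationary y∈B ⟩
    π y                     ≡⟨ πy≡M ⟩
    M                       ≡⟨ *-identityʳ M ⟨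
    M * 1ℚ                  ≡⟨ cong (M *_) (colSum y∈B) ⟨
    M * ∑ B (λ z → P z y)   ≡⟨ ∑-distribˡ-* B M _ ⟨
    ∑ B (λ z → M * P z y)   ∎
    where open ≡-Reasoning

-- Boolean tests and edge subsets

∧-true⁻ : ∀ {a b} → a ∧ b ≡ true → a ≡ true × b ≡ true
∧-true⁻ {true}  b≡true = refl , b≡true
∧-true⁻ {false} ()

⇔⇒≡ : ∀ {a b} → (a ≡ true → b ≡ true) → (b ≡ true → a ≡ true) → a ≡ b
⇔⇒≡ {true}  a⇒b _   = sym (a⇒b refl)
⇔⇒≡ {false} {true}  _ b⇒a = b⇒a refl
⇔⇒≡ {false} {false} _ _   = refl

∈-filterᵇ⁺ : ∀ (φ : A → Bool) {x xs} → x ∈ xs → φ x ≡ true → x ∈ filterᵇ φ xs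
∈-filterᵇ⁺ φ x∈xs φx = ∈-filter⁺ (T? ∘ φ) x∈xs (Equivalence.from T-≡ φx)

∈-filterᵇ⁻ : ∀ (φ : A → Bool) {x} xs → x ∈ filterᵇ φ xs → φ x ≡ true
∈-filterᵇ⁻ φ xs x∈ = Equivalence.to T-≡ (proj₂ (∈-filter⁻ (T? ∘ φ) {xs = xs} x∈))

allFin?⇒ : ∀ {K} (φ : Fin K → Bool) → allFin? φ ≡ true → ∀ i → φ i ≡ true
allFin?⇒ {K} φ all≡true i =
  Equivalence.to T-≡ (All.lookup (all⁺ φ (allFin K) (Equivalence.from T-≡ all≡true)) (∈-allFin i))

==ˢ⇒≡ : ∀ {K} {S S′ : Subset K} → S ==ˢ S′ ≡ true → S ≡ S′
==ˢ⇒≡ h = toWitness (Equivalence.from T-≡ h)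

==ˢ-refl : ∀ {K} (S : Subset K) → S ==ˢ S ≡ true
==ˢ-refl S = trans (isYes≗does (≡-dec Bool._≟_ S S)) (dec-true (≡-dec Bool._≟_ S S) refl)

≢⇒==ˢ-false : ∀ {K} {S S′ : Subset K} → S ≢ S′ → S ==ˢ S′ ≡ false
≢⇒==ˢ-false {S = S} {S′} S≢S′ =
  trans (isYes≗does (≡-dec Bool._≟_ S S′)) (dec-false (≡-dec Bool._≟_ S S′) S≢S′)

δ : ∀ {K} → Subset K → Subset K → ℚ
δ S S′ = if S ==ˢ S′ then 1ℚ else 0ℚ

δ-nonNeg : ∀ {K} (S S′ : Subset K) → 0ℚ ≤ δ S S′
δ-nonNeg S S′ with S ==ˢ S′
... | true  = nonNegative⁻¹ 1ℚ
... | false = ≤-refl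

δ-∷ : ∀ {K} b (S S′ : Subset K) → δ (b ∷ S) (b ∷ S′) ≡ δ S S′
δ-∷ b S S′ with b | ≡-dec Bool._≟_ S S′
... | true  | yes _ = refl
... | true  | no _  = refl
... | false | yes _ = refl
... | false | no _  = refl

allSubsets-complete : ∀ {K} (S : Subset K) → S ∈ allSubsets K
allSubsets-complete []              = here refl
allSubsets-complete {suc K} (true  ∷ S) = ∈-++⁺ˡ (∈-map⁺ (true ∷_) (allSubsets-complete S))
allSubsets-complete {suc K} (false ∷ S) =
  ∈-++⁺ʳ (map (true ∷_) (allSubsets K)) (∈-map⁺ (false ∷_) (allSubsets-complete S))

∑-allSubsets-δ : ∀ {K} (S : Subset K) → ∑ (allSubsets K) (δ S) ≡ 1ℚ
∑-allSubsets-δ [] = refl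
∑-allSubsets-δ {suc K} (b ∷ S) = begin
  ∑ (map (true ∷_) Ss ++ map (false ∷_) Ss) (δ (b ∷ S))
    ≡⟨ ∑-++ (map (true ∷_) Ss) (map (false ∷_) Ss) (δ (b ∷ S)) ⟩
  ∑ (map (true ∷_) Ss) (δ (b ∷ S)) + ∑ (map (false ∷_) Ss) (δ (b ∷ S))
    ≡⟨ cong₂ _+_ (∑-map Ss (true ∷_) (δ (b ∷ S))) (∑-map Ss (false ∷_) (δ (b ∷ S))) ⟩
  ∑ Ss (λ S′ → δ (b ∷ S) (true ∷ S′)) + ∑ Ss (λ S′ → δ (b ∷ S) (false ∷ S′))
    ≡⟨ halves b ⟩
  1ℚ ∎
  where
  open ≡-Reasoning
  Ss = allSubsets K
  ∑-δ-∷ : ∀ b → ∑ Ss (λ S′ → δ (b ∷ S) (b ∷ S′)) ≡ 1ℚ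
  ∑-δ-∷ b = trans (∑-cong Ss (λ S′ _ → δ-∷ b S S′)) (∑-allSubsets-δ S)
  halves : ∀ b → ∑ Ss (λ S′ → δ (b ∷ S) (true ∷ S′)) + ∑ Ss (λ S′ → δ (b ∷ S) (false ∷ S′)) ≡ 1ℚ
  halves true  = cong₂ _+_ (∑-δ-∷ true) (∑-zero Ss)
  halves false = trans (cong₂ _+_ (∑-zero Ss) (∑-δ-∷ false)) (+-identityˡ 1ℚ)

[]≔-revert : ∀ {K} (S : Vec A K) i {b c} → lookup S i ≡ b → (S [ i ]≔ c) [ i ]≔ b ≡ S
[]≔-revert S i Si≡b =
  trans ([]≔-idempotent S i) (trans (cong (S [ i ]≔_) (sym Si≡b)) ([]≔-lookup S i))

countᶠ : ∀ {K} → (Fin K → Bool) → ℕ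
countᶠ {zero}  φ = 0
countᶠ {suc K} φ = (if φ zero then suc else id) (countᶠ (φ ∘ suc))

length-filterᵇ-tabulate : ∀ {K} (φ : A → Bool) (h : Fin K → A) →
                          length (filterᵇ φ (tabulate h)) ≡ countᶠ (φ ∘ h)
length-filterᵇ-tabulate {K = zero}  φ h = refl
length-filterᵇ-tabulate {K = suc K} φ h with φ (h zero)
... | true  = cong suc (length-filterᵇ-tabulate φ (h ∘ suc))
... | false = length-filterᵇ-tabulate φ (h ∘ suc)

countᶠ-not-addE : ∀ {K} (S : Subset K) i → lookup S i ≡ false →
                  countᶠ (not ∘ lookup S) ≡ suc (countᶠ (not ∘ lookup (addE S i)))
countᶠ-not-addE (false ∷ S) zero    _     = refl
countᶠ-not-addE (b     ∷ S) (suc i) Si≡false rewrite countᶠ-not-addE S i Si≡false with b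
... | true  = refl
... | false = refl

nonEdges : ∀ {K} → Subset K → List (Fin K)
nonEdges {K} S = filterᵇ (λ i → not (lookup S i)) (allFin K)

∈-nonEdges⁻ : ∀ {K} {S : Subset K} {i} → i ∈ nonEdges S → lookup S i ≡ false
∈-nonEdges⁻ {K} i∈ = Equivalence.to T-not-≡ (proj₂ (∈-filter⁻ (T? ∘ _) {xs = allFin K} i∈))

length-nonEdges-addE : ∀ {K} (S : Subset K) i → lookup S i ≡ false →
                       length (nonEdges S) ≡ suc (length (nonEdges (addE S i)))
length-nonEdges-addE S i Si≡false
  rewrite length-filterᵇ-tabulate (λ j → not (lookup S j)) id
        | length-filterᵇ-tabulate (λ j → not (lookup (addE S i) j)) id
  = countᶠ-not-addE S i Si≡false

module BUD (G : Graph) (p : Fin (n G) → ℚ) (k : ℕ) (ε : ℚ) where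

  EdgeSet : Set
  EdgeSet = Subset (m G)

  edges : List (Fin (m G))
  edges = allFin (m G)

  inB : EdgeSet → Bool
  inB = inBᵇ G p k ε

  B : List EdgeSet
  B = Bset G p k ε

  P : EdgeSet → EdgeSet → ℚ
  P = budP G p k ε

  inB⇒∈B : ∀ {T} → inB T ≡ true → T ∈ B
  inB⇒∈B {T} = ∈-filterᵇ⁺ inB (allSubsets-complete T)

  ∈B⇒inB : ∀ {T} → T ∈ B → inB T ≡ true
  ∈B⇒inB = ∈-filterᵇ⁻ inB (allSubsets (m G))

  inB⇒reach : ∀ {T} → inB T ≡ true → ∀ u v → reach G T u v ≡ true
  inB⇒reach {T} T∈B u =
    allFin?⇒ _ (allFin?⇒ _ (proj₁ (∧-true⁻ (proj₁ (∧-true⁻ {spanningTreeᵇ G T} T∈B)))) u)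

  ∑-δ-B : ∀ {S} → inB S ≡ true → ∑ B (δ S) ≡ 1ℚ
  ∑-δ-B {S} S∈B = begin
    ∑ B (δ S)                                     ≡⟨ ∑-filterᵇ inB Ss (δ S) ⟩
    ∑ Ss (λ S′ → if inB S′ then δ S S′ else 0ℚ)   ≡⟨ ∑-cong Ss (λ S′ _ → δ-inB S′) ⟩
    ∑ Ss (δ S)                                    ≡⟨ ∑-allSubsets-δ S ⟩
    1ℚ                                            ∎
    where
    open ≡-Reasoning
    Ss = allSubsets (m G)
    δ-inB : ∀ S′ → (if inB S′ then δ S S′ else 0ℚ) ≡ δ S S′
    δ-inB S′ with S ==ˢ S′ in S==S′
    ... | true  rewrite subst (λ X → inB X ≡ true) (==ˢ⇒≡ S==S′) S∈B = refl
    ... | false = if-eta (inB S′)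

  removableᵇ : EdgeSet → Fin (m G) → Bool
  removableᵇ H f = onCycleᵇ G H f ∧ inB (delE H f)

  removable : EdgeSet → List (Fin (m G))
  removable H = filterᵇ (removableᵇ H) edges

  addedEdge-removable : ∀ {T e} → inB T ≡ true → lookup T e ≡ false →
                        removableᵇ (addE T e) e ≡ true
  addedEdge-removable {T} {e} T∈B Te≡false =
    cong₂ _∧_ (cong₂ _∧_ (lookup∘update e T true) e-closes-cycle) (trans (cong inB T+e−e≡T) T∈B)
    where
    T+e−e≡T : delE (addE T e) e ≡ T
    T+e−e≡T = []≔-revert T e Te≡false
    e-closes-cycle : reach G (delE (addE T e) e) (src G e) (tgt G e) ≡ true
    e-closes-cycle =
      trans (cong (λ S → reach G S (src G e) (tgt G e)) T+e−e≡T) (inB⇒reach {T} T∈B _ _)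

  cycleMean : EdgeSet → EdgeSet → ℚ
  cycleMean H T′ = mean (removable H) (λ f → δ (delE H f) T′)

  budStep : List (Fin (m G)) → EdgeSet → EdgeSet → ℚ
  budStep []         T T′ = δ T T′
  budStep es@(_ ∷ _) T T′ = mean es (λ e → cycleMean (addE T e) T′)

  budP-unfold : ∀ T T′ → P T T′ ≡ budStep (nonEdges T) T T′
  budP-unfold T T′ with nonEdges T
  ... | []    = refl
  ... | _ ∷ _ = refl

  budP-nonNeg : ∀ T T′ → 0ℚ ≤ P T T′
  budP-nonNeg T T′ = subst (0ℚ ≤_) (sym (budP-unfold T T′)) (budStep-nonNeg (nonEdges T))
    where
    budStep-nonNeg : ∀ es → 0ℚ ≤ budStep es T T′
    budStep-nonNeg []         = δ-nonNeg T T′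
    budStep-nonNeg es@(_ ∷ _) =
      mean-nonNeg es (λ e _ → mean-nonNeg (removable (addE T e)) (λ f _ → δ-nonNeg _ T′))

  cycleMean-sum : ∀ {T e} → inB T ≡ true → lookup T e ≡ false → ∑ B (cycleMean (addE T e)) ≡ 1ℚ
  cycleMean-sum {T} {e} T∈B Te≡false =
    ∑-mean (removable H) B (λ f → δ (delE H f)) e∈removable (λ f → ∑-δ-B ∘ H−f∈B f)
    where
    H = addE T e
    e∈removable : e ∈ removable H
    e∈removable = ∈-filterᵇ⁺ (removableᵇ H) (∈-allFin e) (addedEdge-removable {T} {e} T∈B Te≡false)
    H−f∈B : ∀ f → f ∈ removable H → inB (delE H f) ≡ true
    H−f∈B f f∈removable =
      proj₂ (∧-true⁻ {onCycleᵇ G H f} (∈-filterᵇ⁻ (removableᵇ H) edges f∈removable))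

  budP-rowSum : ∀ {T} → inB T ≡ true → ∑ B (P T) ≡ 1ℚ
  budP-rowSum {T} T∈B =
    trans (∑-cong B (λ T′ _ → budP-unfold T T′)) (budStep-rowSum (nonEdges T) (∈-nonEdges⁻ {S = T}))
    where
    budStep-rowSum : ∀ es → (∀ {e} → e ∈ es → lookup T e ≡ false) → ∑ B (budStep es T) ≡ 1ℚ
    budStep-rowSum []         _    = ∑-δ-B T∈B
    budStep-rowSum es@(_ ∷ _) es∉T =
      ∑-mean es B (λ e → cycleMean (addE T e)) (here refl) (λ e e∈es → cycleMean-sum T∈B (es∉T e∈es))

  exchangeᵇ : EdgeSet → EdgeSet → Fin (m G) → Fin (m G) → Bool
  exchangeᵇ T T′ e f = not (lookup T e) ∧ (removableᵇ (addE T e) f ∧ (delE (addE T e) f ==ˢ T′))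

  exchange⇒T′+f≡T+e : ∀ {T T′ e f} → exchangeᵇ T T′ e f ≡ true →
                      lookup T e ≡ false × lookup T′ f ≡ false × addE T′ f ≡ addE T e
  exchange⇒T′+f≡T+e {T} {T′} {e} {f} exchange
    with ∧-true⁻ {not (lookup T e)} exchange
  ... | e∉T , f-exchange with ∧-true⁻ {removableᵇ (addE T e) f} f-exchange
  ... | f-removable , H−f==T′ = not-injective e∉T , f∉T′ , T′+f≡H
    where
    H = addE T e
    H−f≡T′ : delE H f ≡ T′
    H−f≡T′ = ==ˢ⇒≡ H−f==T′
    f∈H : lookup H f ≡ true
    f∈H = proj₁ (∧-true⁻ (proj₁ (∧-true⁻ {onCycleᵇ G H f} f-removable)))
    f∉T′ : lookup T′ f ≡ false
    f∉T′ = trans (cong (λ S → lookup S f) (sym H−f≡T′)) (lookup∘update f H false)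
    T′+f≡H : addE T′ f ≡ H
    T′+f≡H = trans (cong (λ S → addE S f) (sym H−f≡T′)) ([]≔-revert H f f∈H)

  exchange-sym : ∀ {T T′ e f} → inB T ≡ true → exchangeᵇ T T′ e f ≡ true →
                 exchangeᵇ T′ T f e ≡ true
  exchange-sym {T} {T′} {e} {f} T∈B exchange with exchange⇒T′+f≡T+e {T} {T′} exchange
  ... | e∉T , f∉T′ , T′+f≡T+e = begin
    not (lookup T′ f) ∧ (removableᵇ (addE T′ f) e ∧ (delE (addE T′ f) e ==ˢ T))
      ≡⟨ cong₂ (λ b H → not b ∧ (removableᵇ H e ∧ (delE H e ==ˢ T))) f∉T′ T′+f≡T+e ⟩
    removableᵇ (addE T e) e ∧ (delE (addE T e) e ==ˢ T)
      ≡⟨ cong₂ _∧_ (addedEdge-removable {T} {e} T∈B e∉T) (cong (_==ˢ T) ([]≔-revert T e e∉T)) ⟩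
    T ==ˢ T
      ≡⟨ ==ˢ-refl T ⟩
    true ∎
    where open ≡-Reasoning

  weight : EdgeSet → EdgeSet → Fin (m G) → Fin (m G) → ℚ
  weight T T′ e f =
    if exchangeᵇ T T′ e f
    then invℕ (length (nonEdges T)) * invℕ (length (removable (addE T e)))
    else 0ℚ

  weight-sym : ∀ {T T′} → inB T ≡ true → inB T′ ≡ true →
               ∀ e f → weight T T′ e f ≡ weight T′ T f e
  weight-sym {T} {T′} T∈B T′∈B e f
    rewrite ⇔⇒≡ (exchange-sym {T} {T′} {e} {f} T∈B) (exchange-sym {T′} {T} {f} {e} T′∈B)
    with exchangeᵇ T′ T f e in exchange
  ... | false = refl
  ... | true with exchange⇒T′+f≡T+e {T′} {T} exchange
  ...   | f∉T′ , e∉T , T+e≡T′+f =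
    cong₂ _*_ (cong invℕ sameNonEdgeCount) (cong (invℕ ∘ length ∘ removable) T+e≡T′+f)
    where
    sameNonEdgeCount : length (nonEdges T) ≡ length (nonEdges T′)
    sameNonEdgeCount = begin
      length (nonEdges T)                   ≡⟨ length-nonEdges-addE T e e∉T ⟩
      suc (length (nonEdges (addE T e)))    ≡⟨ cong (suc ∘ length ∘ nonEdges) T+e≡T′+f ⟩
      suc (length (nonEdges (addE T′ f)))   ≡⟨ length-nonEdges-addE T′ f f∉T′ ⟨
      length (nonEdges T′)                  ∎
      where open ≡-Reasoning

  budP-offDiagonal : ∀ {T T′} → T ≢ T′ →
                     P T T′ ≡ mean (nonEdges T) (λ e → cycleMean (addE T e) T′)
  budP-offDiagonal {T} {T′} T≢T′ = trans (budP-unfold T T′) (budStep-offDiagonal (nonEdges T))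
    where
    budStep-offDiagonal : ∀ es → budStep es T T′ ≡ mean es (λ e → cycleMean (addE T e) T′)
    budStep-offDiagonal []      = cong (λ b → if b then 1ℚ else 0ℚ) (≢⇒==ˢ-false T≢T′)
    budStep-offDiagonal (_ ∷ _) = refl

  budP≡∑∑weight : ∀ {T T′} → T ≢ T′ → P T T′ ≡ ∑ edges (λ e → ∑ edges (weight T T′ e))
  budP≡∑∑weight {T} {T′} T≢T′ = begin
    P T T′
      ≡⟨ budP-offDiagonal T≢T′ ⟩
    mean (nonEdges T) (λ e → cycleMean (addE T e) T′)
      ≡⟨ mean-filterᵇ (λ e → not (lookup T e)) edges (λ e → cycleMean (addE T e) T′) ⟩
    ∑ edges (λ e → if not (lookup T e) then c * cycleMean (addE T e) T′ else 0ℚ)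
      ≡⟨ ∑-cong edges (λ e _ → row e (lookup T e)) ⟩
    ∑ edges (λ e → ∑ edges (weight T T′ e)) ∎
    where
    open ≡-Reasoning
    c = invℕ (length (nonEdges T))
    row : ∀ e b → (if not b then c * cycleMean (addE T e) T′ else 0ℚ) ≡
          ∑ edges (λ f → if not b ∧ (removableᵇ (addE T e) f ∧ (delE (addE T e) f ==ˢ T′))
                           then c * invℕ (length (removable (addE T e))) else 0ℚ)
    row e true  = sym (∑-zero edges)
    row e false = begin
      c * cycleMean H T′
        ≡⟨ cong (c *_) (mean-filterᵇ (removableᵇ H) edges (λ f → δ (delE H f) T′)) ⟩
      c * ∑ edges (λ f → if removableᵇ H f then a * δ (delE H f) T′ else 0ℚ)
        ≡⟨ ∑-distribˡ-* edges c (λ f → if removableᵇ H f then a * δ (delE H f) T′ else 0ℚ) ⟨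
      ∑ edges (λ f → c * (if removableᵇ H f then a * δ (delE H f) T′ else 0ℚ))
        ≡⟨ ∑-cong edges (λ f _ → entry (removableᵇ H f) (delE H f ==ˢ T′)) ⟩
      ∑ edges (λ f → if removableᵇ H f ∧ (delE H f ==ˢ T′) then c * a else 0ℚ) ∎
      where
      H = addE T e
      a = invℕ (length (removable H))
      entry : ∀ b₁ b₂ → c * (if b₁ then a * (if b₂ then 1ℚ else 0ℚ) else 0ℚ) ≡
                        (if b₁ ∧ b₂ then c * a else 0ℚ)
      entry true  true  = cong (c *_) (*-identityʳ a)
      entry true  false = trans (cong (c *_) (*-zeroʳ a)) (*-zeroʳ c)
      entry false _     = *-zeroʳ c

  budP-sym : ∀ {T T′} → inB T ≡ true → inB T′ ≡ true → P T T′ ≡ P T′ T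
  budP-sym {T} {T′} T∈B T′∈B with ≡-dec Bool._≟_ T T′
  ... | yes refl = refl
  ... | no T≢T′  = begin
    P T T′                                          ≡⟨ budP≡∑∑weight T≢T′ ⟩
    ∑ edges (λ e → ∑ edges (weight T T′ e))         ≡⟨ ∑-cong edges (λ e _ → ∑-cong edges (λ f _ →
                                                         weight-sym {T} {T′} T∈B T′∈B e f)) ⟩
    ∑ edges (λ e → ∑ edges (λ f → weight T′ T f e)) ≡⟨ ∑-comm edges edges (λ e f → weight T′ T f e) ⟩
    ∑ edges (λ f → ∑ edges (weight T′ T f))         ≡⟨ budP≡∑∑weight (T≢T′ ∘ sym) ⟨
    P T′ T                                          ∎
    where open ≡-Reasoning

  budP-colSum : ∀ {T′} → inB T′ ≡ true → ∑ B (λ T → P T T′) ≡ 1ℚ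
  budP-colSum {T′} T′∈B =
    trans (∑-cong B (λ T T∈B → budP-sym {T} {T′} (∈B⇒inB T∈B) T′∈B)) (budP-rowSum T′∈B)

  uniform-stationary : IsStationary G p k ε (uniformB G p k ε)
  uniform-stationary T′ T′∈B = begin
    ∑ B (λ T → u * P T T′) ≡⟨ ∑-distribˡ-* B u (λ T → P T T′) ⟩
    u * ∑ B (λ T → P T T′) ≡⟨ cong (u *_) (budP-colSum T′∈B) ⟩
    u * 1ℚ                 ≡⟨ *-identityʳ u ⟩
    u                      ∎
    where
    open ≡-Reasoning
    u = invℕ (length B)

  uniform-distribution : 1 ℕ.≤ length B → IsDistribution G p k ε (uniformB G p k ε)
  uniform-distribution 1≤|B| = (λ _ _ → invℕ-nonNeg (length B)) , ∑-invℕ-length B 1≤|B|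

  stationary-constant : Irreducible G p k ε → ∀ π → IsStationary G p k ε π →
                        ∀ {T₀} → T₀ ∈ B → (∀ {T} → T ∈ B → π T ≤ π T₀) →
                        ∀ {T} → inB T ≡ true → π T ≡ π T₀
  stationary-constant irreducible π stationary {T₀} T₀∈B π≤πT₀ {T} T∈B =
    reaches-max (irreducible T T₀ T∈B (∈B⇒inB T₀∈B)) T∈B refl
    where
    reaches-max : ∀ {S S′} → Reaches G p k ε S S′ → inB S ≡ true → π S′ ≡ π T₀ → π S ≡ π T₀
    reaches-max here _ πS′≡πT₀ = πS′≡πT₀
    reaches-max {S} (step {T₁ = S₁} S₁∈B 0<P S₁⇝S′) S∈B πS′≡πT₀ =
      stationary-max⇒pred-max B P π budP-nonNeg
        (λ {y} y∈B → budP-colSum {y} (∈B⇒inB y∈B)) (λ {y} y∈B → stationary y (∈B⇒inB y∈B)) π≤πT₀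
        (inB⇒∈B {S₁} S₁∈B) (reaches-max S₁⇝S′ S₁∈B πS′≡πT₀) (inB⇒∈B {S} S∈B) 0<P

  stationary-unique : Irreducible G p k ε → ∀ π → IsDistribution G p k ε π →
                      IsStationary G p k ε π → ∀ T → inB T ≡ true → π T ≡ uniformB G p k ε T
  stationary-unique irreducible π (_ , ∑π≡1) stationary T T∈B = begin
    π T              ≡⟨ constant T∈B ⟩
    π T₀             ≡⟨ ∑-const≡1⇒≡invℕ B (trans (∑-cong B (λ S → sym ∘ constant ∘ ∈B⇒inB)) ∑π≡1) ⟩
    invℕ (length B)  ∎
    where
    open ≡-Reasoning
    open Data.List.Extrema (DecTotalOrder.totalOrder ≤-decTotalOrder)
    T₀ : EdgeSet
    T₀ = argmax π T B
    T₀∈B : T₀ ∈ B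
    T₀∈B = argmax-all π {P = _∈ B} (inB⇒∈B {T} T∈B) (All.tabulate id)
    constant : ∀ {S} → inB S ≡ true → π S ≡ π T₀
    constant = stationary-constant irreducible π stationary T₀∈B (All.lookup (f[xs]≤f[argmax] T B))

proposition2p3 : (G : Graph) → IsSimple G → Connected G →
    (p : Fin (n G) → ℚ) → ((v : Fin (n G)) → 0ℚ Data.Rational.< p v) →
    (ε : ℚ) → 0ℚ Data.Rational.≤ ε → (k : ℕ) → 2 ℕ.≤ k →
    (IsStationary G p k ε (uniformB G p k ε) ×
     (1 ℕ.≤ length (Bset G p k ε) → IsDistribution G p k ε (uniformB G p k ε))) ×
    (Irreducible G p k ε → (π : _) → IsDistribution G p k ε π → IsStationary G p k ε π →
       (T : _) → inBᵇ G p k ε T ≡ true → π T ≡ uniformB G p k ε T)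
-- Symmetry of the walk holds for every graph, population and parameters.
proposition2p3 G _ _ p _ ε _ k _ = (uniform-stationary , uniform-distribution) , stationary-unique
  where open BUD G p k ε
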